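{- Let $m,n,k$ be positive integers with $m\geq 2n$, and let $G$ be a finite graph with at least one edge whose odd-girth is at least $2k+1$. Then there is a homomorphism from $G^{(2k-1)}$ to the Schrijver graph $SG(m,n)$ if and only if there is a homomorphism from $G$ to the graph $SG(m,n,k)$.
   Context: A homomorphism $G\to H$ is a map $f:V(G)\to V(H)$ such that $uv\in E(G)$ implies $f(u)f(v)\in E(H)$. The odd-girth of $G$ is the length of a shortest odd cycle of $G$. For a positive integer $j$, $G^{(j)}$ is the graph on $V(G)$ in which $u,v$ are adjacent iff there is a walk of length exactly $j$ between them in $G$ (loops may occur). $[m]=\{1,\dots,m\}$. A subset $S\subseteq[m]$ is $2$-stable if $2\le |x-y|\le m-2$ for all distinct $x,y\in S$. The Schrijver graph $SG(m,n)$ has as vertices the $2$-stable $n$-subsets of $[m]$, two adjacent iff disjoint. The helical graph $H(m,n,k)$ has as vertices all $k$-tuples $(A_1,\dots,A_k)$ of subsets of $[m]$ with $|A_1|=n$, $|A_r|\ge n$ for all $r$, $A_s\cap A_{s+1}=\emptyset$ for $1\le s\le k-1$, and $A_t\subseteq A_{t+2}$ for $1\le t\le k-2$; $(A_1,\dots,A_k)$ and $(B_1,\dots,B_k)$ are adjacent iff $A_i\cap B_i=\emptyset$ for all $1\le i\le k$ and $A_j\subseteq B_{j+1}$, $B_j\subseteq A_{j+1}$ for all $1\le j\le k-1$. $SG(m,n,k)$ is the induced subgraph of $H(m,n,k)$ on those vertices $(A_1,\dots,A_k)$ such that every $A_r$ ($1\le r\le k$) is a union of $2$-stable $n$-subsets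 of $[m]$. -}

module Defs where

open import Data.Nat using (ℕ; zero; suc; _+_; _*_; _≤_; _<_)
open import Data.Fin using (Fin; toℕ)
open import Data.Fin.Subset using (Subset; _∈_; _⊆_; ∣_∣)
open import Data.Product using (Σ; ∃; _×_; _,_)
open import Data.Empty using (⊥)
open import Relation.Nullary using (¬_; Dec)
open import Relation.Binary.PropositionalEquality using (_≡_)

-- General (directed-presentation) graphs: a vertex type and an
-- adjacency relation.  All graphs used below have symmetric adjacency.

record Graph : Set₁ where
  field
    V : Set
    E : V → V → Set
open Graph public

Hom : Graph → Graph → Set
Hom G H = Σ (V G → V H) λ f → ∀ u v → E G u v → E H (f u) (f v)

record FinGraph : Set₁ where
  field
    N     : ℕ
    Adj   : Fin N → Fin N → Set
    sym   : ∀ u v → Adj u v → Adj v u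
    irr   : ∀ u → ¬ Adj u u
    dec   : ∀ u v → Dec (Adj u v)
open FinGraph public

toGraph : FinGraph → Graph
toGraph G = record { V = Fin (N G) ; E = Adj G }

HasEdge : FinGraph → Set
HasEdge G = ∃ λ u → ∃ λ v → Adj G u v

data Walk (G : FinGraph) : ℕ → Fin (N G) → Fin (N G) → Set where
  here : ∀ u → Walk G zero u u
  step : ∀ {j u w v} → Adj G u w → Walk G j w v → Walk G (suc j) u v

power : FinGraph → ℕ → Graph
power G j = record { V = Fin (N G) ; E = Walk G j }

record Cycle (G : FinGraph) (ℓ : ℕ) : Set where
  field
    len≥3 : 3 ≤ ℓ
    c     : Fin ℓ → Fin (N G)
    inj   : ∀ i j → c i ≡ c j → i ≡ j
    next  : ∀ i j → toℕ j ≡ suc (toℕ i) → Adj G (c i) (c j)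
    close : ∀ i j → toℕ i ≡ 0 → suc (toℕ j) ≡ ℓ → Adj G (c j) (c i)

-- odd-girth(G) ≥ g  (vacuous if G has no odd cycle, odd-girth = ∞)
OddGirth≥ : FinGraph → ℕ → Set
OddGirth≥ G g = ∀ t → 1 + 2 * t < g → ¬ Cycle G (1 + 2 * t)

-- Subsets of [m], represented as subsets of Fin m (element i ↔ i+1).

Disjoint : ∀ {m} → Subset m → Subset m → Set
Disjoint S T = ∀ x → x ∈ S → x ∈ T → ⊥

TwoStable : ∀ {m} → Subset m → Set
TwoStable {m} S = ∀ x y → x ∈ S → y ∈ S → toℕ x < toℕ y →
  (2 + toℕ x ≤ toℕ y) × (toℕ y + 2 ≤ toℕ x + m)

StableSet : (m : ℕ) → ℕ → Subset m → Set
StableSet m n S = (∣ S ∣ ≡ n) × TwoStable {m} S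

SG : ℕ → ℕ → Graph
SG m n = record
  { V = Σ (Subset m) (StableSet m n)
  ; E = λ { (S , _) (T , _) → Disjoint S T } }

-- Helical graph H(m,n,k); tuples (A_1,...,A_k) are indexed by Fin k
-- (A_{r} ↔ A (r-1)).

IsHelical : (m n k : ℕ) → (Fin k → Subset m) → Set
IsHelical m n k A =
    (∀ i → toℕ i ≡ 0 → ∣ A i ∣ ≡ n)
  × (∀ i → n ≤ ∣ A i ∣)
  × (∀ i j → toℕ j ≡ suc (toℕ i) → Disjoint (A i) (A j))
  × (∀ i j → toℕ j ≡ 2 + toℕ i → A i ⊆ A j)

HelicalAdj : (m k : ℕ) → (Fin k → Subset m) → (Fin k → Subset m) → Set
HelicalAdj m k A B =
    (∀ i → Disjoint (A i) (B i))
  × (∀ i j → toℕ j ≡ suc (toℕ i) → (A i ⊆ B j) × (B i ⊆ A j))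

H : ℕ → ℕ → ℕ → Graph
H m n k = record
  { V = Σ (Fin k → Subset m) (IsHelical m n k)
  ; E = λ { (A , _) (B , _) → HelicalAdj m k A B } }

UnionOfStable : (m n : ℕ) → Subset m → Set
UnionOfStable m n A =
  ∀ x → x ∈ A → Σ (Subset m) λ S → StableSet m n S × x ∈ S × S ⊆ A

SGk : ℕ → ℕ → ℕ → Graph
SGk m n k = record
  { V = Σ (Fin k → Subset m) (λ A → IsHelical m n k A × (∀ r → UnionOfStable m n (A r)))
  ; E = λ { (A , _) (B , _) → HelicalAdj m k A B } }

module Submission where

-- Given f : G^(2k-1) → SG(m,n), send a non-isolated vertex v to the tuple whose entry r
-- (counting from 0) is the union of f(u) over all u joined to v by a walk of length r.
-- A walk of length a and one of length a+1 from v (a < k), or two walks of length a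
-- from adjacent vertices, combine into an odd walk of length at most 2k-1; going back
-- and forth along an edge stretches it to length exactly 2k-1, so the f-values at its
-- ends are disjoint, which gives all the helical conditions.
-- Conversely, the entry 0 of a homomorphism G → SG(m,n,k) is a homomorphism
-- G^(2k-1) → SG(m,n): it is an n-set that is a union of 2-stable n-sets, hence 2-stable,
-- and the helical inclusions carry the entries 0 at the ends of a walk of length 2k-1
-- into the entries k-1 at the ends of its middle edge, which are disjoint.

open import Defs
open import Data.Nat using (ℕ; zero; suc; _+_; _*_; _∸_; _≤_; _<_; _≤′_; ≤′-refl; ≤′-step; s≤s)
open import Data.Nat.Properties
  using (+-suc; +-comm; +-identityʳ; ≤⇒≤′; ≤-pred; ≤-trans; m≤m+n; <⇒≢; <⇒≤)
open import Data.Fin using (Fin; toℕ; fromℕ; fromℕ<) renaming (zero to fzero; suc to fsuc)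
open import Data.Fin.Properties using (any?; toℕ-fromℕ; toℕ-fromℕ<; toℕ-injective; toℕ<n) renaming (_≟_ to _≟ᶠ_)
open import Data.Fin.Subset using (Subset; _∈_; _⊆_; ∣_∣; Nonempty; inside; outside)
open import Data.Fin.Subset.Properties using (_∈?_; p⊆q⇒∣p∣≤∣q∣; p⊂q⇒∣p∣<∣q∣; ⊆-refl; ⊆-antisym; ⊆-trans)
open import Data.Vec using ([]; _∷_; here; there)
open import Data.Product using (∃; _×_; _,_; proj₁; proj₂)
open import Function.Bundles using (_⇔_; mk⇔)
open import Relation.Nullary using (Dec; yes; no; does; contradiction)
open import Relation.Nullary.Decidable using (map′; _×-dec_)
open import Relation.Unary using (Pred; Decidable)
open import Relation.Binary.PropositionalEquality using (_≡_; refl; trans; cong; subst) renaming (sym to ≡-sym)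

module _ {G : FinGraph} where

  infixr 5 _++ʷ_

  _++ʷ_ : ∀ {i j u v w} → Walk G i u v → Walk G j v w → Walk G (i + j) u w
  here _   ++ʷ q = q
  step e p ++ʷ q = step e (p ++ʷ q)

  reverseʷ : ∀ {j u v} → Walk G j u v → Walk G j v u
  reverseʷ (here u) = here u
  reverseʷ {suc j} {u} {v} (step e p) =
    subst (λ ℓ → Walk G ℓ v u) (+-comm j 1) (reverseʷ p ++ʷ step (FinGraph.sym G _ _ e) (here u))

  splitʷ : ∀ i {j u v} → Walk G (i + j) u v → ∃ λ y → Walk G i u y × Walk G j y v
  splitʷ zero    p          = _ , here _ , p
  splitʷ (suc i) (step e p) with splitʷ i p
  ... | y , p₁ , p₂ = y , step e p₁ , p₂

  walk? : ∀ j u v → Dec (Walk G j u v)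
  walk? zero u v with u ≟ᶠ v
  ... | yes refl = yes (here u)
  ... | no  u≢v  = no λ { (here _) → u≢v refl }
  walk? (suc j) u v =
    map′ (λ (w , e , p) → step e p) (λ { (step e p) → _ , e , p })
         (any? λ w → dec G u w ×-dec walk? j w v)

  extend-odd-walk : ∀ {a b u v} → a ≤ b → Walk G (suc (a + a)) u v → Walk G (suc (b + b)) u v
  extend-odd-walk a≤b = go (≤⇒≤′ a≤b)
    where
    go : ∀ {a b u v} → a ≤′ b → Walk G (suc (a + a)) u v → Walk G (suc (b + b)) u v
    go ≤′-refl p = p
    go {b = suc b} {u} {v} (≤′-step a≤b) p with go a≤b p
    ... | step e q =
      subst (λ ℓ → Walk G (suc ℓ) u v) (≡-sym (+-suc (suc b) b))
            (step e (step (FinGraph.sym G _ _ e) (step e q)))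

  walk-of-length : ∀ j {v w} → Adj G v w → ∃ (Walk G j v)
  walk-of-length zero    {v} e = v , here v
  walk-of-length (suc j)     e with walk-of-length j (FinGraph.sym G _ _ e)
  ... | u , p = u , step e p

select : ∀ {m ℓ} {P : Pred (Fin m) ℓ} → Decidable P → Subset m
select {zero}  P? = []
select {suc m} P? = does (P? fzero) ∷ select (λ x → P? (fsuc x))

∈-select⁺ : ∀ {m ℓ} {P : Pred (Fin m) ℓ} (P? : Decidable P) {x} → P x → x ∈ select P?
∈-select⁺ P? {fzero} px with P? fzero
... | yes _   = here
... | no ¬px  = contradiction px ¬px
∈-select⁺ P? {fsuc x} px = there (∈-select⁺ (λ y → P? (fsuc y)) px)

∈-select⁻ : ∀ {m ℓ} {P : Pred (Fin m) ℓ} (P? : Decidable P) {x} → x ∈ select P? → P x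
∈-select⁻ P? {fzero} x∈ with P? fzero | x∈
... | yes px | _ = px
... | no _   | ()
∈-select⁻ P? {fsuc x} (there x∈) = ∈-select⁻ (λ y → P? (fsuc y)) x∈

⊆-∣≡∣⇒⊇ : ∀ {m} {p q : Subset m} → p ⊆ q → ∣ p ∣ ≡ ∣ q ∣ → q ⊆ p
⊆-∣≡∣⇒⊇ {p = p} p⊆q ∣p∣≡∣q∣ {x} x∈q with x ∈? p
... | yes x∈p = x∈p
... | no  x∉p = contradiction ∣p∣≡∣q∣ (<⇒≢ (p⊂q⇒∣p∣<∣q∣ (p⊆q , x , x∈q , x∉p)))

nonempty : ∀ {m} (p : Subset m) → 1 ≤ ∣ p ∣ → Nonempty p
nonempty (inside  ∷ p) _ = fzero , here
nonempty (outside ∷ p) h with nonempty p h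
... | x , x∈p = fsuc x , there x∈p

TwoStable-⊆ : ∀ {m} {p q : Subset m} → p ⊆ q → TwoStable q → TwoStable p
TwoStable-⊆ p⊆q q-stable x y x∈p y∈p = q-stable x y (p⊆q x∈p) (p⊆q y∈p)

module FromPower (m n k : ℕ) (G : FinGraph) (f : Hom (power G (suc (k + k))) (SG m n)) where

  F : Fin (N G) → Subset m
  F u = proj₁ (proj₁ f u)

  F-stable : ∀ u → StableSet m n (F u)
  F-stable u = proj₂ (proj₁ f u)

  odd-walk⇒disjoint : ∀ {a u v} → a ≤ k → Walk G (a + suc a) u v → Disjoint (F u) (F v)
  odd-walk⇒disjoint {a} {u} {v} a≤k p =
    proj₂ f u v (extend-odd-walk a≤k (subst (λ ℓ → Walk G ℓ u v) (+-suc a a) p))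

  Reaches : ℕ → Fin (N G) → Fin m → Set
  Reaches j v x = ∃ λ u → Walk G j v u × x ∈ F u

  reaches? : ∀ j v → Decidable (Reaches j v)
  reaches? j v x = any? λ u → walk? {G = G} j v u ×-dec x ∈? F u

  reach : ℕ → Fin (N G) → Subset m
  reach j v = select (reaches? j v)

  ∈-reach⁺ : ∀ {j u v x} → Walk G j v u → x ∈ F u → x ∈ reach j v
  ∈-reach⁺ {j} {v = v} p x∈ = ∈-select⁺ (reaches? j v) (_ , p , x∈)

  ∈-reach⁻ : ∀ {j v x} → x ∈ reach j v → Reaches j v x
  ∈-reach⁻ {j} {v} = ∈-select⁻ (reaches? j v)

  ∣reach0∣ : ∀ v → ∣ reach 0 v ∣ ≡ n
  ∣reach0∣ v = trans (cong ∣_∣ (⊆-antisym reach0⊆F (∈-reach⁺ (here v)))) (proj₁ (F-stable v))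
    where
    reach0⊆F : reach 0 v ⊆ F v
    reach0⊆F x∈ with ∈-reach⁻ x∈
    ... | _ , here _ , x∈F = x∈F

  n≤∣reach∣ : ∀ {j u v} → Walk G j v u → n ≤ ∣ reach j v ∣
  n≤∣reach∣ {u = u} p = subst (_≤ _) (proj₁ (F-stable u)) (p⊆q⇒∣p∣≤∣q∣ (∈-reach⁺ p))

  reach-⊆ : ∀ {a c u v} → Walk G c u v → reach a v ⊆ reach (c + a) u
  reach-⊆ q x∈ with ∈-reach⁻ x∈
  ... | _ , p , x∈F = ∈-reach⁺ (q ++ʷ p) x∈F

  reach-disjoint : ∀ {a b c u v} → a ≤ k → c + b ≡ suc a → Walk G c u v →
                   Disjoint (reach a u) (reach b v)
  reach-disjoint {a} a≤k c+b≡1+a q x x∈a x∈b with ∈-reach⁻ x∈a | ∈-reach⁻ x∈b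
  ... | u , p , x∈Fu | v , p′ , x∈Fv =
    odd-walk⇒disjoint a≤k (subst (λ ℓ → Walk G (a + ℓ) u v) c+b≡1+a (reverseʷ p ++ʷ q ++ʷ p′))
      x x∈Fu x∈Fv

  reach-union : ∀ j v → UnionOfStable m n (reach j v)
  reach-union j v x x∈ with ∈-reach⁻ x∈
  ... | u , p , x∈F = F u , F-stable u , x∈F , ∈-reach⁺ p

  tuple : Fin (N G) → Fin (suc k) → Subset m
  tuple v i = reach (toℕ i) v

  helical : ∀ {v w} → Adj G v w → IsHelical m n (suc k) (tuple v)
  helical {v} e =
      (λ i i≡0 → subst (λ j → ∣ reach j v ∣ ≡ n) (≡-sym i≡0) (∣reach0∣ v))
    , (λ i → n≤∣reach∣ (proj₂ (walk-of-length (toℕ i) e)))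
    , (λ i j j≡1+i → subst (λ ℓ → Disjoint (tuple v i) (reach ℓ v)) (≡-sym j≡1+i)
                       (reach-disjoint (index≤k i j j≡1+i) refl (here v)))
    , (λ i j j≡2+i → subst (λ ℓ → tuple v i ⊆ reach ℓ v) (≡-sym j≡2+i)
                       (reach-⊆ (step e (step (FinGraph.sym G _ _ e) (here v)))))
    where
    index≤k : ∀ (i j : Fin (suc k)) → toℕ j ≡ suc (toℕ i) → toℕ i ≤ k
    index≤k i j j≡1+i = <⇒≤ (subst (_≤ k) j≡1+i (≤-pred (toℕ<n j)))

  tuple-adjacent : ∀ {u v} → Adj G u v → HelicalAdj m (suc k) (tuple u) (tuple v)
  tuple-adjacent {u} {v} e =
      (λ i → reach-disjoint (≤-pred (toℕ<n i)) refl (step e (here v)))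
    , (λ i j j≡1+i → subst (λ ℓ → tuple u i ⊆ reach ℓ v) (≡-sym j≡1+i)
                        (reach-⊆ (step (FinGraph.sym G _ _ e) (here u)))
                   , subst (λ ℓ → tuple v i ⊆ reach ℓ u) (≡-sym j≡1+i) (reach-⊆ (step e (here v))))

  vertex : ∀ {v w} → Adj G v w → V (SGk m n (suc k))
  vertex {v} e = tuple v , helical e , λ i → reach-union (toℕ i) v

  hom : HasEdge G → Hom (toGraph G) (SGk m n (suc k))
  hom (_ , _ , e₀) = g , g-adjacent
    where
    has-neighbour? : ∀ v → Dec (∃ (Adj G v))
    has-neighbour? v = any? (dec G v)

    g : Fin (N G) → V (SGk m n (suc k))
    g v with has-neighbour? v
    ... | yes (_ , e) = vertex e
    ... | no  _       = vertex e₀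

    g-adjacent : ∀ u v → Adj G u v → E (SGk m n (suc k)) (g u) (g v)
    g-adjacent u v e with has-neighbour? u | has-neighbour? v
    ... | yes _ | yes _ = tuple-adjacent e
    ... | no ¬u | _     = contradiction (v , e) ¬u
    ... | yes _ | no ¬v = contradiction (u , FinGraph.sym G _ _ e) ¬v

module ToPower (m n k : ℕ) (G : FinGraph) (g : Hom (toGraph G) (SGk m n (suc k))) where

  A : Fin (N G) → Fin (suc k) → Subset m
  A v = proj₁ (proj₁ g v)

  walk⇒⊆ : ∀ {j u v} → Walk G j u v → ∀ (a b : Fin (suc k)) → toℕ b ≡ toℕ a + j → A u a ⊆ A v b
  walk⇒⊆ {u = u} (here _) a b b≡a+0 =
    subst (λ c → A u a ⊆ A u c) (toℕ-injective (≡-sym (trans b≡a+0 (+-identityʳ (toℕ a))))) ⊆-refl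
  walk⇒⊆ {suc j} (step e p) a b b≡a+1+j =
    ⊆-trans (proj₁ (proj₂ (proj₂ g _ _ e) a c (toℕ-fromℕ< c<k+1)))
            (walk⇒⊆ p c b (trans b≡1+a+j (cong (_+ j) (≡-sym (toℕ-fromℕ< c<k+1)))))
    where
    b≡1+a+j : toℕ b ≡ suc (toℕ a + j)
    b≡1+a+j = trans b≡a+1+j (+-suc (toℕ a) j)
    c<k+1 : suc (toℕ a) < suc k
    c<k+1 = ≤-trans (s≤s (s≤s (m≤m+n (toℕ a) j))) (subst (_< suc k) b≡1+a+j (toℕ<n b))
    c : Fin (suc k)
    c = fromℕ< c<k+1

  ∣A₀∣ : ∀ v → ∣ A v fzero ∣ ≡ n
  ∣A₀∣ v = proj₁ (proj₁ (proj₂ (proj₁ g v))) fzero refl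

  A₀-stable : 1 ≤ n → ∀ v → StableSet m n (A v fzero)
  A₀-stable 1≤n v with nonempty (A v fzero) (subst (1 ≤_) (≡-sym (∣A₀∣ v)) 1≤n)
  ... | x , x∈ with proj₂ (proj₂ (proj₁ g v)) fzero x x∈
  ... | S , (∣S∣≡n , S-stable) , _ , S⊆A₀ =
    ∣A₀∣ v , TwoStable-⊆ (⊆-∣≡∣⇒⊇ S⊆A₀ (trans ∣S∣≡n (≡-sym (∣A₀∣ v)))) S-stable

  hom : 1 ≤ n → Hom (power G (suc (k + k))) (SG m n)
  hom 1≤n = (λ v → A v fzero , A₀-stable 1≤n v) , A₀-disjoint
    where
    A₀-disjoint : ∀ v w → Walk G (suc (k + k)) v w → Disjoint (A v fzero) (A w fzero)
    A₀-disjoint v w p with splitʷ k (subst (λ ℓ → Walk G ℓ v w) (≡-sym (+-suc k k)) p)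
    ... | y , p₁ , step e p₂ = λ x x∈Av x∈Aw →
      proj₁ (proj₂ g _ _ e) (fromℕ k) x (walk⇒⊆ p₁ fzero (fromℕ k) (toℕ-fromℕ k) x∈Av)
                                        (walk⇒⊆ (reverseʷ p₂) fzero (fromℕ k) (toℕ-fromℕ k) x∈Aw)

odd-length : ∀ k → 2 * suc k ∸ 1 ≡ suc (k + k)
odd-length k = trans (cong (k +_) (cong suc (+-identityʳ k))) (+-suc k k)

mainTheorem2 : (m n k : ℕ) → 1 ≤ m → 1 ≤ n → 1 ≤ k → 2 * n ≤ m →
    (G : FinGraph) → HasEdge G → OddGirth≥ G (2 * k + 1) →
    Hom (power G (2 * k ∸ 1)) (SG m n) ⇔ Hom (toGraph G) (SGk m n k)
mainTheorem2 m n zero _ _ () _ _ _ _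
mainTheorem2 m n (suc k) _ 1≤n _ _ G has-edge _ rewrite odd-length k =
  mk⇔ (λ f → FromPower.hom m n k G f has-edge) (λ g → ToPower.hom m n k G g 1≤n)
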